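{- Let $\ell\ge1$ and $k\ge2$ be integers with $(\ell,k)\ne(1,2)$, and let $i\in[k]$. Every vertex $u\in S_i^k$ belongs to exactly $(k-1)\ell$ of the sets $S_i^k(v)$, $v\in V^\ell_k\setminus S_i^k$, and for each $v\in V^\ell_k\setminus S_i^k$ the subgraph of $ST^\ell_k$ induced by $\{v\}\cup S_i^k(v)$ is isomorphic to the complete bipartite graph $K_{1,\ell}$ (with center $v$). Moreover, letting $i$ range over $[k]$ and $v$ over $V^\ell_k\setminus S_i^k$, the edge sets of these stars (the $\ell$ edges joining $v$ to $S_i^k(v)$) form a partition of the edge multiset of $2ST^\ell_k$.
   Context: $[k]=\{0,\ldots,k-1\}$. $V^\ell_k$ is the set of all strings of length $k\ell$ over $[k]$ containing exactly $\ell$ occurrences of each symbol of $[k]$. The graph $ST^\ell_k$ has vertex set $V^\ell_k$, with $v=v_0\cdots v_{k\ell-1}$ adjacent to $w$ iff $w$ is obtained from $v$ by swapping the first entry $v_0$ with some entry $v_j$ ($1\le j\le k\ell-1$) such that $v_j\neq v_0$. $S_i^k=\{v\in V^\ell_k: v_0=i\}$. For $v\notin S_i^k$, the dominating $\ell$-set of $v$ with respect to $S_i^k$ is $S_i^k(v)$, the set of neighbors of $v$ lying in $S_i^k$ (it has exactly $\ell$ elements). $2ST^\ell_k$ is the multigraph obtained from $ST^\ell_k$ by replacing each edge by two parallel edges with the same endvertices. -}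

module Defs where

open import Data.Nat using (ℕ; suc; _*_)
open import Data.Fin using (Fin; zero; suc)
open import Data.Fin.Properties using (_≟_)
open import Data.Vec using (Vec; []; _∷_; lookup; _[_]≔_; count)
open import Data.List using (List; length)
open import Data.List.Membership.Propositional using (_∈_)
open import Data.List.Relation.Unary.Unique.Propositional using (Unique)
open import Data.Product using (Σ; _×_)
open import Data.Sum using (_⊎_)
open import Data.Empty using (⊥)
open import Relation.Binary.PropositionalEquality using (_≡_; _≢_)
open import Function.Bundles using (_⇔_)

IsVertex : (k ℓ : ℕ) → Vec (Fin k) (k * ℓ) → Set
IsVertex k ℓ v = (s : Fin k) → count (_≟ s) v ≡ ℓ

-- Adj v w : w is obtained from v by swapping the first entry v₀ with some
-- entry v_j (j ≥ 1, here position suc j) such that v_j ≠ v₀.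
Adj : ∀ {k n} → Vec (Fin k) n → Vec (Fin k) n → Set
Adj [] w = ⊥
Adj {k} {suc m} (x ∷ xs) w =
  Σ (Fin m) λ j → (lookup xs j ≢ x) × (w ≡ (lookup xs j ∷ (xs [ j ]≔ x)))

InS : ∀ {k n} → Fin k → Vec (Fin k) n → Set
InS i [] = ⊥
InS i (x ∷ _) = x ≡ i

InDom : (k ℓ : ℕ) → Fin k → Vec (Fin k) (k * ℓ) → Vec (Fin k) (k * ℓ) → Set
InDom k ℓ i v w = IsVertex k ℓ w × Adj v w × InS i w

HasCard : {A : Set} → (A → Set) → ℕ → Set
HasCard {A} P n =
  Σ (List A) λ xs → Unique xs × (length xs ≡ n) × ((x : A) → (x ∈ xs) ⇔ P x)

StarAdj : {ℓ : ℕ} → Fin (suc ℓ) → Fin (suc ℓ) → Set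
StarAdj a b = (a ≡ zero × b ≢ zero) ⊎ (b ≡ zero × a ≢ zero)

{-# OPTIONS --safe #-}
-- A neighbour of a string x ∷ xs is obtained by swapping x with an entry xⱼ ≠ x of xs, and
-- distinct such positions j give distinct neighbours. Hence the neighbours whose first
-- entry satisfies a predicate Q that x fails are counted by the entries of xs satisfying Q:
-- for u ∈ Sᵢ these are the kℓ − ℓ entries different from i, for v ∉ Sᵢ the ℓ entries
-- equal to i. Adjacent strings have different first entries, so every Sᵢ is independent and
-- {v} ∪ Sᵢ(v) induces a star. Finally an edge {v, w} lies in exactly two stars: that of v
-- with respect to S_{w₀} and that of w with respect to S_{v₀}.
module Submission where

open import Defs
open import Data.Nat using (ℕ; suc; _*_; _∸_; _≤_; _+_)
import Data.Nat as ℕ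
open import Data.Nat.Properties using (+-suc; m+n∸m≡n; *-distribʳ-∸; *-identityˡ)
open import Data.Fin using (Fin; zero; suc)
open import Data.Fin.Properties using (_≟_)
open import Data.Vec using (Vec; []; _∷_; head; lookup; _[_]≔_; count)
import Data.Vec as Vec
open import Data.Vec.Properties
  using (lookup∘update; lookup∘update′; []≔-idempotent; []≔-lookup; tabulate∘lookup;
         ∷-injectiveˡ; ∷-injectiveʳ)
open import Data.List using (List; []; _∷_; map; length; filter; allFin)
import Data.List as List
open import Data.List.Properties using (length-map)
open import Data.List.Membership.Propositional using (_∈_)
open import Data.List.Membership.Propositional.Properties
  using (∈-map⁺; ∈-map⁻; ∈-filter⁺; ∈-filter⁻; ∈-allFin; ∈-lookup)
open import Data.List.Relation.Unary.Any using (here; there; index)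
open import Data.List.Relation.Unary.Any.Properties using (lookup-index)
open import Data.List.Relation.Unary.All using ([]; _∷_)
import Data.List.Relation.Unary.All as All
import Data.List.Relation.Unary.All.Properties as All
open import Data.List.Relation.Unary.AllPairs using ([]; _∷_)
open import Data.List.Relation.Unary.Unique.Propositional using (Unique)
open import Data.List.Relation.Unary.Unique.Propositional.Properties using (filter⁺; allFin⁺)
open import Data.Bool using (true; false; if_then_else_)
open import Data.Product using (Σ; _×_; _,_; proj₁; proj₂)
open import Data.Sum using (_⊎_; inj₁; inj₂)
open import Data.Empty using (⊥-elim)
open import Relation.Nullary using (¬_; yes; no; does; ¬?)
open import Relation.Unary using (Decidable)
open import Relation.Binary.PropositionalEquality
  using (_≡_; _≢_; refl; sym; trans; cong; cong₂; subst; module ≡-Reasoning)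
open import Function using (_∘_; id)
open import Function.Bundles using (_⇔_; mk⇔; Equivalence)
open import Function.Construct.Composition using (_⇔-∘_)
open import Function.Construct.Identity using (⇔-id)
open import Function.Definitions using (Injective)

open ≡-Reasoning
open Equivalence using (to; from)

private
  variable
    A B : Set
    k m n ℓ : ℕ
    P Q : A → Set

Unique⇒lookup-injective : {xs : List A} → Unique xs → Injective _≡_ _≡_ (List.lookup xs)
Unique⇒lookup-injective (_ ∷ _)    {zero}  {zero}  _  = refl
Unique⇒lookup-injective (x∉ ∷ _)   {zero}  {suc b} eq = ⊥-elim (All.lookup x∉ (∈-lookup b) eq)
Unique⇒lookup-injective (x∉ ∷ _)   {suc a} {zero}  eq =
  ⊥-elim (All.lookup x∉ (∈-lookup a) (sym eq))
Unique⇒lookup-injective (_ ∷ uniq) {suc a} {suc b} eq = cong suc (Unique⇒lookup-injective uniq eq)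

Unique-map⁺ : (f : A → B) {xs : List A} →
  (∀ {a b} → a ∈ xs → b ∈ xs → f a ≡ f b → a ≡ b) → Unique xs → Unique (map f xs)
Unique-map⁺ f inj [] = []
Unique-map⁺ f inj (a∉ ∷ uniq) =
  All.map⁺ (All.tabulate λ b∈ fa≡fb →
    All.lookup a∉ b∈ (inj (here refl) (there b∈) fa≡fb))
  ∷ Unique-map⁺ f (λ a∈ b∈ → inj (there a∈) (there b∈)) uniq

HasCard-cong : (∀ x → P x ⇔ Q x) → HasCard P n → HasCard Q n
HasCard-cong P⇔Q (xs , uniq , len , ∈⇔P) = xs , uniq , len , λ x → P⇔Q x ⇔-∘ ∈⇔P x

HasCard-image : (f : A → B) → (∀ {a b} → P a → P b → f a ≡ f b → a ≡ b) →
  HasCard P n → HasCard (λ y → Σ A λ a → P a × f a ≡ y) n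
HasCard-image {P = P} f inj (xs , uniq , len , ∈⇔P) =
  map f xs ,
  Unique-map⁺ f (λ a∈ b∈ → inj (to (∈⇔P _) a∈) (to (∈⇔P _) b∈)) uniq ,
  trans (length-map f xs) len ,
  λ y → mk⇔ image⁺ image⁻
  where
  image⁺ : ∀ {y} → y ∈ map f xs → Σ _ λ a → P a × f a ≡ y
  image⁺ y∈ with ∈-map⁻ f y∈
  ... | a , a∈ , refl = a , to (∈⇔P a) a∈ , refl
  image⁻ : ∀ {y} → (Σ _ λ a → P a × f a ≡ y) → y ∈ map f xs
  image⁻ (a , pa , refl) = ∈-map⁺ f (from (∈⇔P a) pa)

HasCard⇒enumeration : HasCard P n →
  Σ (Fin n → A) λ g →
    Injective _≡_ _≡_ g × (∀ a → P (g a)) × (∀ {x} → P x → Σ (Fin n) λ a → g a ≡ x)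
HasCard⇒enumeration (xs , uniq , refl , ∈⇔P) =
  List.lookup xs ,
  Unique⇒lookup-injective uniq ,
  (λ a → to (∈⇔P _) (∈-lookup a)) ,
  λ px → let x∈ = from (∈⇔P _) px in index x∈ , sym (lookup-index x∈)

length-filter-tabulate : (P? : Decidable P) (f : B → A) (g : Fin n → B) →
  length (filter (P? ∘ f) (List.tabulate g)) ≡ count P? (Vec.tabulate (f ∘ g))
length-filter-tabulate {n = ℕ.zero}  P? f g = refl
length-filter-tabulate {n = ℕ.suc n} P? f g with does (P? (f (g zero)))
... | true  = cong suc (length-filter-tabulate P? f (g ∘ suc))
... | false = length-filter-tabulate P? f (g ∘ suc)

positions-HasCard : (P? : Decidable P) (xs : Vec A n) →
  HasCard (λ j → P (lookup xs j)) (count P? xs)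
positions-HasCard P? xs =
  filter (P? ∘ lookup xs) (allFin _) ,
  filter⁺ (P? ∘ lookup xs) (allFin⁺ _) ,
  trans (length-filter-tabulate P? (lookup xs) id) (cong (count P?) (tabulate∘lookup xs)) ,
  λ j → mk⇔ (proj₂ ∘ ∈-filter⁻ (P? ∘ lookup xs) {xs = allFin _})
             (∈-filter⁺ (P? ∘ lookup xs) (∈-allFin j))

InducesStar : (A → A → Set) → A → (A → Set) → ℕ → Set
InducesStar {A} E c D ℓ =
  Σ (Fin (suc ℓ) → A) λ φ →
    (φ zero ≡ c) × Injective _≡_ _≡_ φ
    × ((w : A) → ((w ≡ c) ⊎ D w) ⇔ Σ (Fin (suc ℓ)) (λ a → φ a ≡ w))
    × ((a b : Fin (suc ℓ)) → E (φ a) (φ b) ⇔ StarAdj a b)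

independentNeighbours⇒InducesStar : {E : A → A → Set} {c : A} {D : A → Set} →
  (∀ {v w} → E v w → E w v) → ¬ E c c → (∀ {w} → D w → E c w) →
  (∀ {w w′} → D w → D w′ → ¬ E w w′) → HasCard D ℓ → InducesStar E c D ℓ
independentNeighbours⇒InducesStar {A = A} {ℓ = ℓ} {E = E} {c} {D} E-sym ¬Ecc D⊆N[c] D-independent card
  with HasCard⇒enumeration card
... | g , g-injective , g∈D , g-onto = φ , refl , φ-injective , φ-image , φ-adjacency
  where
  φ : Fin (suc ℓ) → A
  φ zero    = c
  φ (suc a) = g a

  c≢g : ∀ a → c ≢ g a
  c≢g a c≡ga = ¬Ecc (subst (E c) (sym c≡ga) (D⊆N[c] (g∈D a)))

  φ-injective : Injective _≡_ _≡_ φ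
  φ-injective {zero}  {zero}  _  = refl
  φ-injective {zero}  {suc b} eq = ⊥-elim (c≢g b eq)
  φ-injective {suc a} {zero}  eq = ⊥-elim (c≢g a (sym eq))
  φ-injective {suc a} {suc b} eq = cong suc (g-injective eq)

  φ-image : ∀ w → ((w ≡ c) ⊎ D w) ⇔ Σ (Fin (suc ℓ)) (λ a → φ a ≡ w)
  φ-image w = mk⇔
    (λ { (inj₁ refl) → zero , refl ; (inj₂ Dw) → let a , ga≡w = g-onto Dw in suc a , ga≡w })
    (λ { (zero , refl) → inj₁ refl ; (suc a , refl) → inj₂ (g∈D a) })

  φ-adjacency : ∀ a b → E (φ a) (φ b) ⇔ StarAdj a b
  φ-adjacency zero    zero    = mk⇔ (⊥-elim ∘ ¬Ecc)
                                    λ { (inj₁ (_ , 0≢0)) → ⊥-elim (0≢0 refl)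
                                      ; (inj₂ (_ , 0≢0)) → ⊥-elim (0≢0 refl) }
  φ-adjacency zero    (suc b) = mk⇔ (λ _ → inj₁ (refl , λ ())) (λ _ → D⊆N[c] (g∈D b))
  φ-adjacency (suc a) zero    = mk⇔ (λ _ → inj₂ (refl , λ ())) (λ _ → E-sym (D⊆N[c] (g∈D a)))
  φ-adjacency (suc a) (suc b) = mk⇔ (⊥-elim ∘ D-independent (g∈D a) (g∈D b))
                                    λ { (inj₁ (() , _)) ; (inj₂ (() , _)) }

swapFirst : Vec A (suc m) → Fin m → Vec A (suc m)
swapFirst (x ∷ xs) j = lookup xs j ∷ (xs [ j ]≔ x)

module _ {P : A → Set} (P? : Decidable P) where

  count-∷-¬ : ∀ {x} (xs : Vec A n) → ¬ P x → count P? (x ∷ xs) ≡ count P? xs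
  count-∷-¬ {x = x} xs ¬px with P? x
  ... | yes px = ⊥-elim (¬px px)
  ... | no _   = refl

  count-complement : (xs : Vec A n) → count P? xs + count (¬? ∘ P?) xs ≡ n
  count-complement []       = refl
  count-complement (x ∷ xs) with P? x
  ... | yes _ = cong suc (count-complement xs)
  ... | no _  = trans (+-suc _ _) (cong suc (count-complement xs))

  count-¬ : (xs : Vec A n) → count (¬? ∘ P?) xs ≡ n ∸ count P? xs
  count-¬ {n} xs = begin
    count (¬? ∘ P?) xs
      ≡⟨ m+n∸m≡n (count P? xs) _ ⟨
    count P? xs + count (¬? ∘ P?) xs ∸ count P? xs
      ≡⟨ cong (_∸ count P? xs) (count-complement xs) ⟩
    n ∸ count P? xs
      ∎

  count-swap₀₁ : (x y : A) (xs : Vec A m) → count P? (x ∷ y ∷ xs) ≡ count P? (y ∷ x ∷ xs)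
  count-swap₀₁ x y xs with does (P? x) | does (P? y)
  ... | true  | true  = refl
  ... | true  | false = refl
  ... | false | true  = refl
  ... | false | false = refl

  count-swapFirst : (v : Vec A (suc m)) (j : Fin m) → count P? (swapFirst v j) ≡ count P? v
  count-swapFirst (x ∷ y ∷ ys) zero    = count-swap₀₁ y x ys
  count-swapFirst (x ∷ y ∷ ys) (suc j) = begin
    count P? (lookup ys j ∷ y ∷ (ys [ j ]≔ x))
      ≡⟨ count-swap₀₁ (lookup ys j) y (ys [ j ]≔ x) ⟩
    count P? (y ∷ swapFirst (x ∷ ys) j)
      ≡⟨ cong (if does (P? y) then suc else id) (count-swapFirst (x ∷ ys) j) ⟩
    count P? (y ∷ x ∷ ys)
      ≡⟨ count-swap₀₁ y x ys ⟩
    count P? (x ∷ y ∷ ys)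
      ∎

swapFirst-involutive : (v : Vec A (suc m)) (j : Fin m) → swapFirst (swapFirst v j) j ≡ v
swapFirst-involutive (x ∷ xs) j =
  cong₂ _∷_ (lookup∘update j xs x) (trans ([]≔-idempotent xs j) ([]≔-lookup xs j))

swapFirst-injective : (x : A) (xs : Vec A m) {j j′ : Fin m} → lookup xs j ≢ x →
  swapFirst (x ∷ xs) j ≡ swapFirst (x ∷ xs) j′ → j ≡ j′
swapFirst-injective x xs {j} {j′} xⱼ≢x eq with j ≟ j′
... | yes j≡j′ = j≡j′
... | no j≢j′  = ⊥-elim (xⱼ≢x (begin
  lookup xs j               ≡⟨ lookup∘update′ j≢j′ xs x ⟨
  lookup (xs [ j′ ]≔ x) j   ≡⟨ cong (λ ys → lookup ys j) (∷-injectiveʳ eq) ⟨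
  lookup (xs [ j ]≔ x) j    ≡⟨ lookup∘update j xs x ⟩
  x                         ∎))

-- IsVertex for strings of arbitrary length, so that lemmas can split on the string.
Balanced : ℕ → Vec (Fin k) n → Set
Balanced {k} ℓ v = (s : Fin k) → count (_≟ s) v ≡ ℓ

Adj-sym : {v w : Vec (Fin k) n} → Adj v w → Adj w v
Adj-sym {v = x ∷ xs} (j , xⱼ≢x , refl) =
  j , (λ eq → xⱼ≢x (trans (sym eq) (lookup∘update j xs x))) ,
  sym (swapFirst-involutive (x ∷ xs) j)

InS-independent : (i : Fin k) {v w : Vec (Fin k) n} → InS i v → InS i w → ¬ Adj v w
InS-independent i {[]}     ()
InS-independent i {x ∷ xs} {_ ∷ _} refl refl (j , xⱼ≢x , eq) =
  xⱼ≢x (sym (∷-injectiveˡ eq))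

Adj-irrefl : {v : Vec (Fin k) n} → ¬ Adj v v
Adj-irrefl {v = []}     ()
Adj-irrefl {v = x ∷ xs} = InS-independent x refl refl

Adj-preserves-Balanced : {v w : Vec (Fin k) n} → Adj v w → Balanced ℓ v → Balanced ℓ w
Adj-preserves-Balanced {v = []}     ()
Adj-preserves-Balanced {v = x ∷ xs} (j , _ , refl) bal s =
  trans (count-swapFirst (_≟ s) (x ∷ xs) j) (bal s)

neighbours-HasCard : {Q : Fin k → Set} (Q? : Decidable Q) (x : Fin k) (xs : Vec (Fin k) m) →
  ¬ Q x →
  HasCard (λ w → Adj (x ∷ xs) w × Q (head w)) (count Q? xs)
neighbours-HasCard {Q = Q} Q? x xs ¬Qx =
  HasCard-cong image⇔neighbour
    (HasCard-image (swapFirst (x ∷ xs))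
      (λ Qxⱼ _ → swapFirst-injective x xs (Qxⱼ⇒xⱼ≢x Qxⱼ))
      (positions-HasCard Q? xs))
  where
  Qxⱼ⇒xⱼ≢x : ∀ {j} → Q (lookup xs j) → lookup xs j ≢ x
  Qxⱼ⇒xⱼ≢x Qxⱼ xⱼ≡x = ¬Qx (subst Q xⱼ≡x Qxⱼ)
  image⇔neighbour : ∀ w → (Σ (Fin _) λ j → Q (lookup xs j) × swapFirst (x ∷ xs) j ≡ w)
                        ⇔ (Adj (x ∷ xs) w × Q (head w))
  image⇔neighbour w = mk⇔
    (λ { (j , Qxⱼ , refl) → (j , Qxⱼ⇒xⱼ≢x Qxⱼ , refl) , Qxⱼ })
    (λ { ((j , _ , refl) , Qxⱼ) → j , Qxⱼ , refl })

dominatedBy-HasCard : (i : Fin k) (u : Vec (Fin k) n) → Balanced ℓ u → InS i u →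
  HasCard (λ v → Balanced ℓ v × ¬ InS i v × (Balanced ℓ u × Adj v u × InS i u)) (n ∸ ℓ)
dominatedBy-HasCard {n = n} {ℓ = ℓ} i (.i ∷ xs) bal refl =
  subst (HasCard _) count≡
    (HasCard-cong neighbour⇔dominated (neighbours-HasCard i≢? i xs ¬i≢i))
  where
  i≢? : Decidable (_≢ i)
  i≢? = ¬? ∘ (_≟ i)
  ¬i≢i : ¬ (i ≢ i)
  ¬i≢i i≢i = i≢i refl
  count≡ : count i≢? xs ≡ n ∸ ℓ
  count≡ = begin
    count i≢? xs                   ≡⟨ count-∷-¬ i≢? xs ¬i≢i ⟨
    count i≢? (i ∷ xs)             ≡⟨ count-¬ (_≟ i) (i ∷ xs) ⟩
    n ∸ count (_≟ i) (i ∷ xs)      ≡⟨ cong (n ∸_) (bal i) ⟩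
    n ∸ ℓ                          ∎
  neighbour⇔dominated : ∀ v → (Adj (i ∷ xs) v × head v ≢ i) ⇔
    (Balanced ℓ v × ¬ InS i v × (Balanced ℓ (i ∷ xs) × Adj v (i ∷ xs) × InS i (i ∷ xs)))
  neighbour⇔dominated (y ∷ ys) = mk⇔
    (λ (adj , y≢i) → Adj-preserves-Balanced adj bal , y≢i , bal , Adj-sym adj , refl)
    (λ (_ , y≢i , _ , adj , _) → Adj-sym adj , y≢i)

dominatingSet-HasCard : (i : Fin k) (v : Vec (Fin k) n) → Balanced ℓ v → ¬ InS i v →
  HasCard (λ w → Balanced ℓ w × Adj v w × InS i w) ℓ
dominatingSet-HasCard i []       bal _   = [] , [] , bal i , λ _ → mk⇔ (λ ()) λ ()
dominatingSet-HasCard {ℓ = ℓ} i (x ∷ xs) bal x≢i =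
  subst (HasCard _) count≡
    (HasCard-cong neighbour⇔dominating (neighbours-HasCard (_≟ i) x xs x≢i))
  where
  count≡ : count (_≟ i) xs ≡ ℓ
  count≡ = trans (sym (count-∷-¬ (_≟ i) xs x≢i)) (bal i)
  neighbour⇔dominating : ∀ w →
    (Adj (x ∷ xs) w × head w ≡ i) ⇔ (Balanced ℓ w × Adj (x ∷ xs) w × InS i w)
  neighbour⇔dominating w = mk⇔
    (λ { (adj@(_ , _ , refl) , wᵢ) → Adj-preserves-Balanced adj bal , adj , wᵢ })
    (λ { (_ , adj@(_ , _ , refl) , wᵢ) → adj , wᵢ })

CoversEdge : ℕ → (v w : Vec (Fin k) n) → Fin k × Vec (Fin k) n × Vec (Fin k) n → Set
CoversEdge ℓ v w (i , c , x) =
  (Balanced ℓ c × ¬ InS i c × (Balanced ℓ x × Adj c x × InS i x))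
  × (((c ≡ v) × (x ≡ w)) ⊎ ((c ≡ w) × (x ≡ v)))

CoversEdge-HasCard : {v w : Vec (Fin k) n} → Balanced ℓ v → Adj v w →
  HasCard (CoversEdge ℓ v w) 2
CoversEdge-HasCard {ℓ = ℓ} {v = x ∷ xs} bal adj@(j , xⱼ≢x , refl) =
  stars , ((λ eq → xⱼ≢x (cong proj₁ eq)) ∷ []) ∷ [] ∷ [] , refl ,
  λ t → mk⇔ (stars⁺ t) (stars⁻ t)
  where
  v w : Vec (Fin _) _
  v = x ∷ xs
  w = swapFirst v j
  stars : List (Fin _ × Vec (Fin _) _ × Vec (Fin _) _)
  stars = (lookup xs j , v , w) ∷ (x , w , v) ∷ []
  stars⁺ : ∀ t → t ∈ stars → CoversEdge ℓ v w t
  stars⁺ _ (here refl) =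
    (bal , xⱼ≢x ∘ sym , (Adj-preserves-Balanced adj bal , adj , refl)) , inj₁ (refl , refl)
  stars⁺ _ (there (here refl)) =
    (Adj-preserves-Balanced adj bal , xⱼ≢x , (bal , Adj-sym adj , refl)) , inj₂ (refl , refl)
  stars⁻ : ∀ t → CoversEdge ℓ v w t → t ∈ stars
  stars⁻ _ ((_ , _ , (_ , _ , refl)) , inj₁ (refl , refl)) = here refl
  stars⁻ _ ((_ , _ , (_ , _ , refl)) , inj₂ (refl , refl)) = there (here refl)

corollary3 : (ℓ k : ℕ) → 1 ≤ ℓ → 2 ≤ k → ¬ ((ℓ ≡ 1) × (k ≡ 2)) →
    -- (1) each u ∈ S_i^k lies in exactly (k-1)ℓ sets S_i^k(v), v ∈ V \ S_i^k
    ((i : Fin k) (u : Vec (Fin k) (k * ℓ)) → IsVertex k ℓ u → InS i u →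
      HasCard (λ v → IsVertex k ℓ v × ¬ InS i v × InDom k ℓ i v u) ((k ∸ 1) * ℓ))
    ×
    -- (2) for v ∈ V \ S_i^k, the subgraph induced by {v} ∪ S_i^k(v) is
    -- isomorphic to K_{1,ℓ} with center v
    ((i : Fin k) (v : Vec (Fin k) (k * ℓ)) → IsVertex k ℓ v → ¬ InS i v →
      Σ (Fin (suc ℓ) → Vec (Fin k) (k * ℓ)) λ φ →
        (φ zero ≡ v)
        × Injective _≡_ _≡_ φ
        × ((w : Vec (Fin k) (k * ℓ)) →
             ((w ≡ v) ⊎ InDom k ℓ i v w) ⇔ Σ (Fin (suc ℓ)) (λ a → φ a ≡ w))
        × ((a b : Fin (suc ℓ)) → Adj (φ a) (φ b) ⇔ StarAdj a b))
    ×
    -- (3) the star edge sets {c, x} (i ∈ [k], c ∈ V \ S_i^k, x ∈ S_i^k(c))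
    -- partition the edge multiset of 2ST^ℓ_k: every star edge is an edge of
    -- ST^ℓ_k, and every edge {v, w} of ST^ℓ_k is covered by exactly two
    -- (= its multiplicity in 2ST^ℓ_k) star edges counted with multiplicity.
    (((i : Fin k) (c x : Vec (Fin k) (k * ℓ)) →
        IsVertex k ℓ c → ¬ InS i c → InDom k ℓ i c x → Adj c x)
     ×
     ((v w : Vec (Fin k) (k * ℓ)) → IsVertex k ℓ v → IsVertex k ℓ w → Adj v w →
        HasCard {Fin k × Vec (Fin k) (k * ℓ) × Vec (Fin k) (k * ℓ)}
          (λ { (i , c , x) → (IsVertex k ℓ c × ¬ InS i c × InDom k ℓ i c x)
                 × (((c ≡ v) × (x ≡ w)) ⊎ ((c ≡ w) × (x ≡ v))) })
          2))
corollary3 ℓ k _ _ _ =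
  (λ i u bal uᵢ → subst (HasCard _) k*ℓ∸ℓ≡[k∸1]*ℓ (dominatedBy-HasCard i u bal uᵢ)) ,
  (λ i v bal v∉Sᵢ → independentNeighbours⇒InducesStar Adj-sym Adj-irrefl
    (λ (_ , adj , _) → adj)
    (λ (_ , _ , wᵢ) (_ , _ , w′ᵢ) → InS-independent i wᵢ w′ᵢ)
    (dominatingSet-HasCard i v bal v∉Sᵢ)) ,
  (λ _ _ _ _ _ (_ , adj , _) → adj) ,
  (λ v w bal _ adj → HasCard-cong (λ { (i , c , x) → ⇔-id _ }) (CoversEdge-HasCard bal adj))
  where
  k*ℓ∸ℓ≡[k∸1]*ℓ : k * ℓ ∸ ℓ ≡ (k ∸ 1) * ℓ
  k*ℓ∸ℓ≡[k∸1]*ℓ = begin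
    k * ℓ ∸ ℓ        ≡⟨ cong (k * ℓ ∸_) (*-identityˡ ℓ) ⟨
    k * ℓ ∸ 1 * ℓ    ≡⟨ *-distribʳ-∸ ℓ k 1 ⟨
    (k ∸ 1) * ℓ      ∎
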